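{- Let $F$ be an irreducible binary cubic form with integer coefficients, positive discriminant $D$ and Hessian $H$. Then for all integer solutions $(x_1,y_1)$ of the equation $F(x,y)=1$, except possibly one solution, one has $H(x_1,y_1)\ge \frac12\sqrt{3D}$.
   Context: For $F(x,y)=ax^3+bx^2y+cxy^2+dy^3$ the discriminant is $D=18abcd+b^2c^2-27a^2d^2-4ac^3-4b^3d$ and the Hessian is $H(x,y)=Ax^2+Bxy+Cy^2$ with $A=b^2-3ac$, $B=bc-9ad$, $C=c^2-3bd$ (equivalently $H=-\frac14\left(F_{xx}F_{yy}-F_{xy}^2\right)$); one has $B^2-4AC=-3D$. -}

module Defs where

open import Data.Integer using (ℤ; _+_; _*_; _-_; _≤_; _<_; +_; -_)
import Data.Rational as ℚ
open import Data.Rational using (ℚ)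
open import Data.Product using (Σ; ∃; _×_; _,_)
open import Relation.Binary.PropositionalEquality using (_≡_)
open import Relation.Nullary using (¬_)

record Cubic : Set where
  constructor cubic
  field
    a b c d : ℤ
open Cubic public

eval : Cubic → ℤ → ℤ → ℤ
eval F x y = a F * x * x * x + b F * x * x * y + c F * x * y * y + d F * y * y * y

disc : Cubic → ℤ
disc (cubic a b c d) =
  + 18 * a * b * c * d + b * b * c * c - + 27 * a * a * d * d
  - + 4 * a * c * c * c - + 4 * b * b * b * d

hessian : Cubic → ℤ → ℤ → ℤ
hessian (cubic a b c d) x y =
  (b * b - + 3 * a * c) * x * x + (b * c - + 9 * a * d) * x * y + (c * c - + 3 * b * d) * y * y

-- Irreducibility over ℚ: F (viewed in ℚ[x,y]) is not the product of a linear form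
-- p x + q y and a quadratic form r x^2 + s x y + t y^2 with rational coefficients
-- (the only possible non-trivial factorization of a nonzero binary cubic form).
-- (p x + q y)(r x^2 + s x y + t y^2)
--   = pr x^3 + (ps + qr) x^2 y + (pt + qs) x y^2 + qt y^3.
Factorization : Cubic → ℚ → ℚ → ℚ → ℚ → ℚ → Set
Factorization F p q r s t =
  (ℚ._/_ (a F) 1 ≡ p ℚ.* r) ×
  (ℚ._/_ (b F) 1 ≡ p ℚ.* s ℚ.+ q ℚ.* r) ×
  (ℚ._/_ (c F) 1 ≡ p ℚ.* t ℚ.+ q ℚ.* s) ×
  (ℚ._/_ (d F) 1 ≡ q ℚ.* t)

Irreducible : Cubic → Set
Irreducible F = ¬ (Σ ℚ λ p → Σ ℚ λ q → Σ ℚ λ r → Σ ℚ λ s → Σ ℚ λ t → Factorization F p q r s t)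

{-# OPTIONS --safe #-}
-- The Hessian H is a positive definite quadratic form with 4AC − B² = 3D, and
-- 4 H(u) H(v) = (polar form of H at u, v)² + 3D · det(u, v)².
-- Hence two solutions u, v of F = 1 with 4H² < 3D satisfy det(u, v) = 0, and
-- two solutions on a line through the origin coincide by homogeneity of F. Since 4H(x, y)² < 3D forces |x| < C and
-- |y| < A, the exceptional solution, if any, is found by a finite search.
module Submission where

open import Defs
open import Data.Integer using (ℤ; _*_; _≤_; _<_; +_)
open import Data.Product using (Σ; _×_; _,_)
open import Relation.Binary.PropositionalEquality using (_≡_)
open import Relation.Nullary using (¬_)

open import Data.Integer using (_+_; _-_; -_; ∣_∣; +[1+_]; -[1+_]; +≤+; -≤+; +<+; Positive; NonNegative; positive; nonNegative)
open import Data.Integer.Properties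
open import Data.Integer.Tactic.RingSolver using (solve-∀)
import Data.Nat as ℕ
import Data.Nat.Properties as ℕₚ
open import Data.Product using (∃; proj₁; proj₂)
open import Data.Sum using (_⊎_; inj₁; inj₂; [_,_]′)
open import Function using (_∘_)
open import Relation.Binary.PropositionalEquality using (refl; sym; trans; cong; cong₂; subst; module ≡-Reasoning)
open import Relation.Nullary using (Dec; yes; no; contradiction; map′; _×-dec_; _⊎-dec_)

0≤i*i : ∀ i → + 0 ≤ i * i
0≤i*i (+ 0)     = +≤+ ℕ.z≤n
0≤i*i +[1+ n ]  = +≤+ ℕ.z≤n
0≤i*i -[1+ n ]  = +≤+ ℕ.z≤n

i≢0⇒1≤i*i : ∀ {i} → ¬ i ≡ + 0 → + 1 ≤ i * i
i≢0⇒1≤i*i {+ 0}     i≢0 = contradiction refl i≢0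
i≢0⇒1≤i*i {+[1+ n ]} _  = +≤+ (ℕ.s≤s ℕ.z≤n)
i≢0⇒1≤i*i { -[1+ n ]} _ = +≤+ (ℕ.s≤s ℕ.z≤n)

0≤i⇒0≤j⇒0≤i*j : ∀ {i j} → + 0 ≤ i → + 0 ≤ j → + 0 ≤ i * j
0≤i⇒0≤j⇒0≤i*j {i} 0≤i 0≤j =
  subst (_≤ i * _) (*-zeroʳ i) (*-monoˡ-≤-nonNeg i {{nonNegative 0≤i}} 0≤j)

∣i∣≤i*i : ∀ i → + ∣ i ∣ ≤ i * i
∣i∣≤i*i (+ 0)     = +≤+ ℕ.z≤n
∣i∣≤i*i +[1+ n ]  = +≤+ (ℕₚ.m≤m*n (ℕ.suc n) (ℕ.suc n))
∣i∣≤i*i -[1+ n ]  = +≤+ (ℕₚ.m≤m*n (ℕ.suc n) (ℕ.suc n))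

i≤i*i : ∀ i → i ≤ i * i
i≤i*i (+ 0)     = +≤+ ℕ.z≤n
i≤i*i +[1+ n ]  = ∣i∣≤i*i +[1+ n ]
i≤i*i -[1+ n ]  = -≤+

+m<i⇒m<∣i∣ : ∀ {m i} → + m < i → m ℕ.< ∣ i ∣
+m<i⇒m<∣i∣ (+<+ m<n) = m<n

0≤i*i*i⇒0≤i : ∀ {i} → + 0 ≤ i * i * i → + 0 ≤ i
0≤i*i*i⇒0≤i {+ n}      _  = +≤+ ℕ.z≤n
0≤i*i*i⇒0≤i { -[1+ n ]} ()

i*i+3j*j≡0⇒j≡0 : ∀ i j → i * i + + 3 * (j * j) ≡ + 0 → j ≡ + 0
i*i+3j*j≡0⇒j≡0 i (+ 0)      _ = refl
i*i+3j*j≡0⇒j≡0 i +[1+ n ]  e = contradiction (+-mono-≤-< (0≤i*i i) (+<+ (ℕ.s≤s ℕ.z≤n))) (<-irrefl (sym e))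
i*i+3j*j≡0⇒j≡0 i -[1+ n ]  e = contradiction (+-mono-≤-< (0≤i*i i) (+<+ (ℕ.s≤s ℕ.z≤n))) (<-irrefl (sym e))

i*i+i*j+j*j≡0⇒i≡j : ∀ i j → i * i + i * j + j * j ≡ + 0 → i ≡ j
i*i+i*j+j*j≡0⇒i≡j i j e =
  trans (i*i+3j*j≡0⇒j≡0 (i + + 2 * j) i (trans (identity i j) (cong (+ 4 *_) e)))
        (sym (i*i+3j*j≡0⇒j≡0 (j + + 2 * i) j (trans (identity j i) (cong (+ 4 *_) (trans (comm i j) e)))))
  where
  identity : ∀ i j → (i + + 2 * j) * (i + + 2 * j) + + 3 * (i * i) ≡ + 4 * (i * i + i * j + j * j)
  identity = solve-∀
  comm : ∀ i j → j * j + j * i + i * i ≡ i * i + i * j + j * j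
  comm = solve-∀

cube-injective : ∀ {i j} → i * i * i ≡ j * j * j → i ≡ j
cube-injective {i} {j} i³≡j³ =
  [ i-j≡0⇒i≡j i j , i*i+i*j+j*j≡0⇒i≡j i j ]′
    (i*j≡0⇒i≡0∨j≡0 (i - j) (trans (factorise i j) (i≡j⇒i-j≡0 i³≡j³)))
  where
  factorise : ∀ i j → (i - j) * (i * i + i * j + j * j) ≡ i * i * i - j * j * j
  factorise = solve-∀

anyAbs<? : ∀ {P : ℤ → Set} → (∀ z → Dec (P z)) → ∀ n → Dec (∃ λ z → ∣ z ∣ ℕ.< n × P z)
anyAbs<? {P} P? n = map′ fromℕ toℕ (ℕₚ.anyUpTo? (λ m → P? (+ m) ⊎-dec P? (- + m)) n)
  where
  fromℕ : (∃ λ m → m ℕ.< n × (P (+ m) ⊎ P (- + m))) → ∃ λ z → ∣ z ∣ ℕ.< n × P z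
  fromℕ (m , m<n , inj₁ P[+m]) = + m , m<n , P[+m]
  fromℕ (m , m<n , inj₂ P[-m]) = - + m , subst (ℕ._< n) (sym (∣-i∣≡∣i∣ (+ m))) m<n , P[-m]
  toℕ : (∃ λ z → ∣ z ∣ ℕ.< n × P z) → ∃ λ m → m ℕ.< n × (P (+ m) ⊎ P (- + m))
  toℕ (+ m      , m<n , Pz) = m , m<n , inj₁ Pz
  toℕ (-[1+ m ] , m<n , Pz) = ℕ.suc m , m<n , inj₂ Pz

vanishes-off-one-point : ∀ {P : ℤ → ℤ → Set} → (∀ x y → Dec (P x y)) → ∀ m n →
  (∀ {x y} → P x y → ∣ x ∣ ℕ.< m × ∣ y ∣ ℕ.< n) →
  (∀ {x y x′ y′} → P x y → P x′ y′ → (x , y) ≡ (x′ , y′)) →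
  Σ ℤ λ x₀ → Σ ℤ λ y₀ → ∀ x y → ¬ (x , y) ≡ (x₀ , y₀) → ¬ P x y
vanishes-off-one-point P? m n bounded unique with anyAbs<? (λ x → anyAbs<? (P? x) n) m
... | yes (x₀ , _ , y₀ , _ , P[x₀,y₀]) = x₀ , y₀ , λ x y ≢x₀y₀ P[x,y] → ≢x₀y₀ (unique P[x,y] P[x₀,y₀])
... | no none = + 0 , + 0 , λ x y _ P[x,y] →
  none (x , proj₁ (bounded P[x,y]) , y , proj₂ (bounded P[x,y]) , P[x,y])

record QuadraticForm : Set where
  constructor quadraticForm
  field
    A B C : ℤ
open QuadraticForm

⟦_⟧ : QuadraticForm → ℤ → ℤ → ℤ
⟦ quadraticForm A B C ⟧ x y = A * x * x + B * x * y + C * y * y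

δ : QuadraticForm → ℤ
δ (quadraticForm A B C) = + 4 * A * C - B * B

swap : QuadraticForm → QuadraticForm
swap (quadraticForm A B C) = quadraticForm C B A

⟦swap⟧ : ∀ q x y → ⟦ swap q ⟧ y x ≡ ⟦ q ⟧ x y
⟦swap⟧ q x y = identity (A q) (B q) (C q) x y
  where
  identity : ∀ A B C x y → C * y * y + B * y * x + A * x * x ≡ A * x * x + B * x * y + C * y * y
  identity = solve-∀

δ-swap : ∀ q → δ (swap q) ≡ δ q
δ-swap q = identity (A q) (B q) (C q)
  where
  identity : ∀ A B C → + 4 * C * A - B * B ≡ + 4 * A * C - B * B
  identity = solve-∀

A*4q≡square+δ*y² : ∀ A B C x y →
  A * (+ 4 * (A * x * x + B * x * y + C * y * y))
    ≡ (+ 2 * A * x + B * y) * (+ 2 * A * x + B * y) + (+ 4 * A * C - B * B) * (y * y)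
A*4q≡square+δ*y² = solve-∀

4qq′≡polar²+δ*det² : ∀ A B C x y x′ y′ →
  + 4 * (A * x * x + B * x * y + C * y * y) * (A * x′ * x′ + B * x′ * y′ + C * y′ * y′)
    ≡ (+ 2 * A * x * x′ + B * (x * y′ + x′ * y) + + 2 * C * y * y′) * (+ 2 * A * x * x′ + B * (x * y′ + x′ * y) + + 2 * C * y * y′)
      + (+ 4 * A * C - B * B) * ((x * y′ - x′ * y) * (x * y′ - x′ * y))
4qq′≡polar²+δ*det² = solve-∀

0<δ⇒0<A*4C : ∀ q → + 0 < δ q → + 0 < A q * (+ 4 * C q)
0<δ⇒0<A*4C q 0<δ = subst (+ 0 <_) (identity (A q) (B q) (C q)) (+-mono-≤-< (0≤i*i (B q)) 0<δ)
  where
  identity : ∀ A B C → B * B + (+ 4 * A * C - B * B) ≡ A * (+ 4 * C)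
  identity = solve-∀

record PositiveDefinite (q : QuadraticForm) : Set where
  field
    0<A : + 0 < A q
    0<δ : + 0 < δ q

0≤A⇒0<δ⇒positiveDefinite : ∀ {q} → + 0 ≤ A q → + 0 < δ q → PositiveDefinite q
0≤A⇒0<δ⇒positiveDefinite {q} 0≤A 0<δ = record
  { 0<A = ≤∧≢⇒< 0≤A (λ 0≡A → <-irrefl (cong (_* (+ 4 * C q)) 0≡A) (0<δ⇒0<A*4C q 0<δ))
  ; 0<δ = 0<δ
  }

-- q(x, y) < √δ / 2, squared to stay in ℤ.
Small : QuadraticForm → ℤ → ℤ → Set
Small q x y = + 4 * (⟦ q ⟧ x y * ⟦ q ⟧ x y) < δ q

module _ {q : QuadraticForm} (pd : PositiveDefinite q) where
  open PositiveDefinite pd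
  open ≤-Reasoning

  private instance
    A⁺ : Positive (A q)
    A⁺ = positive 0<A
    A⁰ : NonNegative (A q)
    A⁰ = nonNegative (<⇒≤ 0<A)
    δ⁺ : Positive (δ q)
    δ⁺ = positive 0<δ
    δ⁰ : NonNegative (δ q)
    δ⁰ = nonNegative (<⇒≤ 0<δ)

  0≤⟦⟧ : ∀ x y → + 0 ≤ ⟦ q ⟧ x y
  0≤⟦⟧ x y = *-cancelˡ-≤-pos (+ 0) _ (+ 4) (*-cancelˡ-≤-pos (+ 0) _ (A q) (begin
    A q * + 0                                 ≡⟨ *-zeroʳ (A q) ⟩
    + 0                                       ≤⟨ +-mono-≤ (0≤i*i s) (0≤i⇒0≤j⇒0≤i*j (<⇒≤ 0<δ) (0≤i*i y)) ⟩
    s * s + δ q * (y * y)                     ≡⟨ A*4q≡square+δ*y² (A q) (B q) (C q) x y ⟨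
    A q * (+ 4 * ⟦ q ⟧ x y)                   ∎))
    where
    s : ℤ
    s = + 2 * A q * x + B q * y

  small⇒y*y<A : ∀ {x y} → Small q x y → y * y < A q
  small⇒y*y<A {x} {y} small = *-cancelˡ-<-nonNeg (δ q) (begin-strict
    δ q * (y * y)                             ≤⟨ i≤j+i _ (s * s) {{nonNegative (0≤i*i s)}} ⟩
    s * s + δ q * (y * y)                     ≡⟨ A*4q≡square+δ*y² (A q) (B q) (C q) x y ⟨
    A q * (+ 4 * ⟦ q ⟧ x y)                   ≤⟨ *-monoˡ-≤-nonNeg (A q) (*-monoˡ-≤-nonNeg (+ 4) (i≤i*i _)) ⟩
    A q * (+ 4 * (⟦ q ⟧ x y * ⟦ q ⟧ x y))     <⟨ *-monoˡ-<-pos (A q) small ⟩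
    A q * δ q                                 ≡⟨ *-comm (A q) (δ q) ⟩
    δ q * A q                                 ∎)
    where
    s : ℤ
    s = + 2 * A q * x + B q * y

  small⇒∣y∣<A : ∀ {x y} → Small q x y → + ∣ y ∣ < A q
  small⇒∣y∣<A {y = y} small = ≤-<-trans (∣i∣≤i*i y) (small⇒y*y<A small)

  0<C : + 0 < C q
  0<C = *-cancelˡ-<-nonNeg (+ 4) (*-cancelˡ-<-nonNeg (A q)
          (subst (_< A q * (+ 4 * C q)) (sym (*-zeroʳ (A q))) (0<δ⇒0<A*4C q 0<δ)))

  swap-positiveDefinite : PositiveDefinite (swap q)
  swap-positiveDefinite = record { 0<A = 0<C ; 0<δ = subst (+ 0 <_) (sym (δ-swap q)) 0<δ }

  δ≤4qq′ : ∀ {x y x′ y′} → ¬ x * y′ ≡ x′ * y → δ q ≤ + 4 * ⟦ q ⟧ x y * ⟦ q ⟧ x′ y′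
  δ≤4qq′ {x} {y} {x′} {y′} nonCollinear = begin
    δ q                                       ≡⟨ *-identityʳ (δ q) ⟨
    δ q * + 1                                 ≤⟨ *-monoˡ-≤-nonNeg (δ q) (i≢0⇒1≤i*i (nonCollinear ∘ i-j≡0⇒i≡j _ _)) ⟩
    δ q * (det * det)                         ≤⟨ i≤j+i _ (p * p) {{nonNegative (0≤i*i p)}} ⟩
    p * p + δ q * (det * det)                 ≡⟨ 4qq′≡polar²+δ*det² (A q) (B q) (C q) x y x′ y′ ⟨
    + 4 * ⟦ q ⟧ x y * ⟦ q ⟧ x′ y′             ∎
    where
    det : ℤ
    det = x * y′ - x′ * y
    p : ℤ
    p = + 2 * A q * x * x′ + B q * (x * y′ + x′ * y) + + 2 * C q * y * y′

  small∧small⇒collinear : ∀ {x y x′ y′} → Small q x y → Small q x′ y′ → x * y′ ≡ x′ * y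
  small∧small⇒collinear {x} {y} {x′} {y′} small small′ with x * y′ ≟ x′ * y
  ... | yes collinear = collinear
  ... | no nonCollinear = contradiction (begin-strict
    δ q * δ q                                 ≤⟨ *-monoˡ-≤-nonNeg (δ q) δ≤P ⟩
    δ q * P                                   ≤⟨ *-monoʳ-≤-nonNeg P {{nonNegative (≤-trans (<⇒≤ 0<δ) δ≤P)}} δ≤P ⟩
    P * P                                     ≡⟨ identity h h′ ⟩
    + 4 * (h * h) * (+ 4 * (h′ * h′))         ≤⟨ *-monoˡ-≤-nonNeg (+ 4 * (h * h)) {{nonNegative 0≤4h²}} (<⇒≤ small′) ⟩
    + 4 * (h * h) * δ q                       <⟨ *-monoʳ-<-pos (δ q) small ⟩
    δ q * δ q                                 ∎) (<-irrefl refl)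
    where
    h h′ P : ℤ
    h = ⟦ q ⟧ x y
    h′ = ⟦ q ⟧ x′ y′
    P = + 4 * h * h′
    δ≤P : δ q ≤ P
    δ≤P = δ≤4qq′ nonCollinear
    0≤4h² : + 0 ≤ + 4 * (h * h)
    0≤4h² = 0≤i⇒0≤j⇒0≤i*j {+ 4} (+≤+ ℕ.z≤n) (0≤i*i h)
    identity : ∀ h h′ → (+ 4 * h * h′) * (+ 4 * h * h′) ≡ + 4 * (h * h) * (+ 4 * (h′ * h′))
    identity = solve-∀

small⇒∣x∣<C : ∀ {q} → PositiveDefinite q → ∀ {x y} → Small q x y → + ∣ x ∣ < C q
small⇒∣x∣<C {q} pd {x} {y} small = small⇒∣y∣<A (swap-positiveDefinite pd) small-swapped
  where
  small-swapped : Small (swap q) y x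
  small-swapped rewrite ⟦swap⟧ q x y | δ-swap q = small

hessianForm : Cubic → QuadraticForm
hessianForm (cubic a b c d) =
  quadraticForm (b * b - + 3 * a * c) (b * c - + 9 * a * d) (c * c - + 3 * b * d)

δ-hessianForm : ∀ F → δ (hessianForm F) ≡ + 3 * disc F
δ-hessianForm F = identity (a F) (b F) (c F) (d F)
  where
  identity : ∀ a b c d →
    + 4 * (b * b - + 3 * a * c) * (c * c - + 3 * b * d) - (b * c - + 9 * a * d) * (b * c - + 9 * a * d)
      ≡ + 3 * (+ 18 * a * b * c * d + b * b * c * c - + 27 * a * a * d * d - + 4 * a * c * c * c - + 4 * b * b * b * d)
  identity = solve-∀

0<disc⇒0≤A : ∀ F → + 0 < disc F → + 0 ≤ A (hessianForm F)
0<disc⇒0≤A F 0<D = 0≤i*i*i⇒0≤i (*-cancelˡ-≤-pos (+ 0) _ (+ 4) (begin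
  + 0                                       ≤⟨ +-mono-≤ (0≤i*i s) (0≤i⇒0≤j⇒0≤i*j 0≤27a² (<⇒≤ 0<D)) ⟩
  s * s + + 27 * (a F * a F) * disc F       ≡⟨ identity (a F) (b F) (c F) (d F) ⟩
  + 4 * (A′ * A′ * A′)                      ∎))
  where
  open ≤-Reasoning
  A′ s : ℤ
  A′ = A (hessianForm F)
  s = + 2 * b F * b F * b F - + 9 * a F * b F * c F + + 27 * a F * a F * d F
  0≤27a² : + 0 ≤ + 27 * (a F * a F)
  0≤27a² = 0≤i⇒0≤j⇒0≤i*j {+ 27} (+≤+ ℕ.z≤n) (0≤i*i (a F))
  identity : ∀ a b c d →
    (+ 2 * b * b * b - + 9 * a * b * c + + 27 * a * a * d) * (+ 2 * b * b * b - + 9 * a * b * c + + 27 * a * a * d)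
      + + 27 * (a * a) * (+ 18 * a * b * c * d + b * b * c * c - + 27 * a * a * d * d - + 4 * a * c * c * c - + 4 * b * b * b * d)
      ≡ + 4 * ((b * b - + 3 * a * c) * (b * b - + 3 * a * c) * (b * b - + 3 * a * c))
  identity = solve-∀

hessian-positiveDefinite : ∀ F → + 0 < disc F → PositiveDefinite (hessianForm F)
hessian-positiveDefinite F 0<D =
  0≤A⇒0<δ⇒positiveDefinite (0<disc⇒0≤A F 0<D)
    (subst (+ 0 <_) (sym (δ-hessianForm F)) (*-monoˡ-<-pos (+ 3) 0<D))

eval-homogeneous : ∀ F t x y → eval F (t * x) (t * y) ≡ t * t * t * eval F x y
eval-homogeneous F t x y = identity (a F) (b F) (c F) (d F) t x y
  where
  identity : ∀ a b c d t x y →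
    a * (t * x) * (t * x) * (t * x) + b * (t * x) * (t * x) * (t * y) + c * (t * x) * (t * y) * (t * y) + d * (t * y) * (t * y) * (t * y)
      ≡ t * t * t * (a * x * x * x + b * x * x * y + c * x * y * y + d * y * y * y)
  identity = solve-∀

collinear-solutions : ∀ F {x y x′ y′} → eval F x y ≡ + 1 → eval F x′ y′ ≡ + 1 →
  x * y′ ≡ x′ * y → (x , y) ≡ (x′ , y′)
collinear-solutions F {x} {y} {x′} {y′} F[x,y]≡1 F[x′,y′]≡1 xy′≡x′y =
  cong₂ _,_ (cube-injective x³≡x′³) (cube-injective y³≡y′³)
  where
  open ≡-Reasoning
  scale : ∀ t {u v} → eval F u v ≡ + 1 → eval F (t * u) (t * v) ≡ t * t * t
  scale t {u} {v} F[u,v]≡1 = begin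
    eval F (t * u) (t * v)  ≡⟨ eval-homogeneous F t u v ⟩
    t * t * t * eval F u v  ≡⟨ cong (t * t * t *_) F[u,v]≡1 ⟩
    t * t * t * + 1         ≡⟨ *-identityʳ (t * t * t) ⟩
    t * t * t               ∎
  x³≡x′³ : x * x * x ≡ x′ * x′ * x′
  x³≡x′³ = begin
    x * x * x                 ≡⟨ scale x F[x′,y′]≡1 ⟨
    eval F (x * x′) (x * y′)  ≡⟨ cong₂ (eval F) (*-comm x x′) xy′≡x′y ⟩
    eval F (x′ * x) (x′ * y)  ≡⟨ scale x′ F[x,y]≡1 ⟩
    x′ * x′ * x′              ∎
  y³≡y′³ : y * y * y ≡ y′ * y′ * y′
  y³≡y′³ = begin
    y * y * y                 ≡⟨ scale y F[x′,y′]≡1 ⟨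
    eval F (y * x′) (y * y′)  ≡⟨ cong₂ (eval F) (trans (*-comm y x′) (trans (sym xy′≡x′y) (*-comm x y′))) (*-comm y y′) ⟩
    eval F (y′ * x) (y′ * y)  ≡⟨ scale y′ F[x,y]≡1 ⟩
    y′ * y′ * y′              ∎

lemma2p1 : (F : Cubic) → Irreducible F → + 0 < disc F →
  Σ ℤ λ x₀ → Σ ℤ λ y₀ → (x y : ℤ) → eval F x y ≡ + 1 → ¬ ((x , y) ≡ (x₀ , y₀)) →
    (+ 0 ≤ hessian F x y) × (+ 3 * disc F ≤ + 4 * (hessian F x y * hessian F x y))
lemma2p1 F _ 0<D =
  let x₀ , y₀ , not-exceptional = vanishes-off-one-point exceptional? ∣ C q ∣ ∣ A q ∣ bounded unique in
  x₀ , y₀ , λ x y F[x,y]≡1 ≢x₀y₀ →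
      0≤⟦⟧ pd x y
    , subst (_≤ + 4 * (⟦ q ⟧ x y * ⟦ q ⟧ x y)) (δ-hessianForm F)
        (≮⇒≥ λ small → not-exceptional x y ≢x₀y₀ (F[x,y]≡1 , small))
  where
  q : QuadraticForm
  q = hessianForm F
  pd : PositiveDefinite q
  pd = hessian-positiveDefinite F 0<D
  Exceptional : ℤ → ℤ → Set
  Exceptional x y = eval F x y ≡ + 1 × Small q x y
  exceptional? : ∀ x y → Dec (Exceptional x y)
  exceptional? x y = (eval F x y ≟ + 1) ×-dec (+ 4 * (⟦ q ⟧ x y * ⟦ q ⟧ x y) <? δ q)
  bounded : ∀ {x y} → Exceptional x y → ∣ x ∣ ℕ.< ∣ C q ∣ × ∣ y ∣ ℕ.< ∣ A q ∣
  bounded (_ , small) = +m<i⇒m<∣i∣ (small⇒∣x∣<C pd small) , +m<i⇒m<∣i∣ (small⇒∣y∣<A pd small)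
  unique : ∀ {x y x′ y′} → Exceptional x y → Exceptional x′ y′ → (x , y) ≡ (x′ , y′)
  unique (F[x,y]≡1 , small) (F[x′,y′]≡1 , small′) =
    collinear-solutions F F[x,y]≡1 F[x′,y′]≡1 (small∧small⇒collinear pd small small′)
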